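{- Let $G$ be a graph of order $n$ with clique number $\omega(G)$, let $s,r$ be integers with $1\leq s\leq r<\omega(G)$, and let $\alpha\geq 0$ be real. If \[ (s+1)\,k_{s+1}(G)\geq n^{s+1}\prod_{t=1}^{s}\left(\frac{r-t}{rt}+\alpha\right), \] then \[ k_{r+1}(G)\geq\alpha\,\frac{r^{2}}{r+1}\left(\frac{n}{r}\right)^{r+1}. \]
   Context: For a graph $G$, $k_s(G)$ denotes the number of $s$-cliques (complete subgraphs on $s$ vertices) of $G$, and $\omega(G)$ is the clique number, the largest $s$ with $k_s(G)>0$. The parameter $\alpha$ may depend on $n$.
   Formalization: The parameter α ranges over the nonnegative rationals instead of the nonnegative reals. -}

module Defs where

open import Data.Bool using (Bool; true; false; _∧_; if_then_else_)
open import Data.Nat as ℕ using (ℕ; zero; suc; _⊔_)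
open import Data.Integer as ℤ using (ℤ; +_)
open import Data.Rational as ℚ using (ℚ; 0ℚ; 1ℚ)
open import Data.Fin using (Fin)
open import Data.Fin.Subset using (Subset; _∈_; ∣_∣)
open import Data.Vec using (Vec; []; _∷_)
open import Data.List using (List; []; _∷_; map; _++_; length; filter)
open import Relation.Binary.PropositionalEquality using (_≡_)
open import Relation.Nullary using (¬_)
open import Relation.Nullary.Decidable using (Dec; yes; no; _×-dec_; ⌊_⌋)
open import Data.Product using (_×_)
open import Data.Fin.Properties using (all?)
import Data.Nat.Properties as ℕP

record Graph (n : ℕ) : Set where
  field
    Adj      : Fin n → Fin n → Bool
    symmetric : ∀ i j → Adj i j ≡ Adj j i
    irreflexive : ∀ i → Adj i i ≡ false
open Graph public

allSubsets : (n : ℕ) → List (Subset n)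
allSubsets zero = [] ∷ []
allSubsets (suc n) = map (false ∷_) (allSubsets n) ++ map (true ∷_) (allSubsets n)

IsClique : ∀ {n} → Graph n → Subset n → Set
IsClique {n} G S = ∀ (i j : Fin n) → i ∈ S → j ∈ S → ¬ (i ≡ j) → Adj G i j ≡ true

isClique? : ∀ {n} (G : Graph n) (S : Subset n) → Dec (IsClique G S)
isClique? {n} G S = all? λ i → all? λ j → mem? i (mem? j (neq? i j))
  where
  open import Data.Fin.Subset.Properties using (_∈?_)
  open import Relation.Nullary.Decidable using (_→-dec_; ¬?)
  import Data.Fin.Properties as FP
  import Data.Bool.Properties as BP
  mem? : (i : Fin n) → {A : Set} → Dec A → Dec (i ∈ S → A)
  mem? i d = (i ∈? S) →-dec d
  neq? : (i j : Fin n) → Dec (¬ (i ≡ j) → Adj G i j ≡ true)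
  neq? i j = ¬? (i FP.≟ j) →-dec (Adj G i j BP.≟ true)

k : ∀ {n} → ℕ → Graph n → ℕ
k {n} s G = length (filter (λ S → (∣ S ∣ ℕ.≟ s) ×-dec isClique? G S) (allSubsets n))

ω : ∀ {n} → Graph n → ℕ
ω {n} G = go (allSubsets n)
  where
  go : List (Subset n) → ℕ
  go [] = 0
  go (S ∷ Ss) = if ⌊ isClique? G S ⌋ then ∣ S ∣ ⊔ go Ss else go Ss

-- a / b as a rational (convention: a / 0 = 0; only used with b ≠ 0)
infixl 7 _/ℚ_
_/ℚ_ : ℤ → ℕ → ℚ
a /ℚ zero = 0ℚ
a /ℚ suc b = a ℚ./ suc b

ι : ℕ → ℚ
ι m = + m /ℚ 1

infixr 8 _^ℚ_
_^ℚ_ : ℚ → ℕ → ℚ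
q ^ℚ zero = 1ℚ
q ^ℚ suc m = q ℚ.* (q ^ℚ m)

prod1to : ℕ → (ℕ → ℚ) → ℚ
prod1to zero f = 1ℚ
prod1to (suc s) f = prod1to s f ℚ.* f (suc s)

-- For a t-clique C let e(C) be the number of vertices extending C to a (t+1)-clique.
-- Double counting pairs (clique, vertex) gives Σ e(C) = (t+1) k_{t+1}; and since a vertex
-- extends at most one of the t-subcliques S - u of a (t+1)-clique S unless it extends S
-- itself (and then it extends all t+1 of them), Σ e(C)² ≤ n k_{t+1} + t (t+2) k_{t+2}.
-- Cauchy–Schwarz turns this into the Moon–Moser inequality, which for b_t = t k_t reads
-- t(t+1) b_{t+1}² ≤ b_t (n b_{t+1} + t(t+1) b_{t+2}).
-- With c_t = (r-t)/(rt) one has t(t+1) c_t = t(t+1) c_{t+1} + 1, which makes the property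
-- b_{t+1} ≥ (c_t + α) n b_t propagate from t to t+1 for t < r; where it fails, b_{t+1} stays
-- strictly below n^{t+1} ∏_{i≤t} (c_i + α).  So the hypothesis forces the property at s, and
-- then b_{r+1} ≥ n^{r+1} ∏_{t≤r} (c_t + α) ≥ α n^{r+1} / r^{r-1}, because c_r = 0 and
-- ∏_{t<r} c_t = r^{1-r}.

module Submission where

open import Defs

module CliqueCounting where

  import Data.Nat.Properties as ℕP
  open import Algebra.Properties.CommutativeSemigroup ℕP.+-commutativeSemigroup using (interchange)
  open import Algebra.Properties.CommutativeSemigroup ℕP.*-commutativeSemigroup using (x∙yz≈y∙xz)
  open import Algebra.Properties.Semiring.Sum ℕP.+-*-semiring
    using (sum-syntax; ∑-distrib-+; ∑-comm; *-distribˡ-sum; *-distribʳ-sum; sum-cong-≗)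
    renaming (sum to ∑)
  open import Data.Bool using (if_then_else_)
  open import Data.Fin using (Fin; zero; suc)
  import Data.Fin.Properties as FinP
  open import Data.Fin.Subset using (Subset; inside; outside; _∈_; _∉_; _⊆_; ∣_∣)
  open import Data.Fin.Subset.Properties using (_∈?_)
  open import Data.List using (List; []; _∷_; _++_; map; filter; length)
  import Data.List.Properties as ListP
  open import Data.Nat as ℕ using (ℕ; zero; suc; _+_; _*_; _≤_; z≤n)
  open import Data.Nat.ListAction using (sum)
  open import Data.Nat.ListAction.Properties using (sum-++)
  open import Data.Nat.Tactic.RingSolver using (solve-∀)
  open import Data.Product using (_×_; _,_; proj₁)
  open import Data.Sum using ([_,_]′)
  open import Data.Vec using ([]; _∷_; lookup; _[_]≔_; here; there)
  import Data.Vec.Properties as VecP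
  open import Function using (_∘_)
  open import Level using (Level)
  open import Relation.Binary.PropositionalEquality
  open import Relation.Nullary using (Dec; yes; no; does; ¬_; contradiction)
  open import Relation.Nullary.Decidable using (_×-dec_; ¬?; decidable-stable)
  open import Relation.Unary using (Pred; Decidable)

  private variable
    a : Level
    A B : Set a
    m n t x y : ℕ
    f g : Subset n → ℕ
    G : Graph n
    C S : Subset n
    u v : Fin n

  -- Sums over all subsets

  ∑ˢ : (Subset n → ℕ) → ℕ
  ∑ˢ {zero}  f = f []
  ∑ˢ {suc n} f = ∑ˢ (f ∘ (outside ∷_)) + ∑ˢ (f ∘ (inside ∷_))

  sum-map-allSubsets : (f : Subset n → ℕ) → sum (map f (allSubsets n)) ≡ ∑ˢ f
  sum-map-allSubsets {zero}  f = ℕP.+-identityʳ (f [])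
  sum-map-allSubsets {suc n} f = begin
    sum (map f (map (outside ∷_) Ss ++ map (inside ∷_) Ss))
      ≡⟨ cong sum (ListP.map-++ f (map (outside ∷_) Ss) _) ⟩
    sum (map f (map (outside ∷_) Ss) ++ map f (map (inside ∷_) Ss))
      ≡⟨ sum-++ (map f (map (outside ∷_) Ss)) _ ⟩
    sum (map f (map (outside ∷_) Ss)) + sum (map f (map (inside ∷_) Ss))
      ≡⟨ cong₂ (λ xs ys → sum xs + sum ys) (ListP.map-∘ Ss) (ListP.map-∘ Ss) ⟨
    sum (map (f ∘ (outside ∷_)) Ss) + sum (map (f ∘ (inside ∷_)) Ss)
      ≡⟨ cong₂ _+_ (sum-map-allSubsets (f ∘ (outside ∷_))) (sum-map-allSubsets (f ∘ (inside ∷_))) ⟩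
    ∑ˢ f ∎
    where open ≡-Reasoning; Ss = allSubsets n

  ∑ˢ-cong : (∀ S → f S ≡ g S) → ∑ˢ f ≡ ∑ˢ g
  ∑ˢ-cong {zero}  f≗g = f≗g []
  ∑ˢ-cong {suc n} f≗g = cong₂ _+_ (∑ˢ-cong (f≗g ∘ (outside ∷_))) (∑ˢ-cong (f≗g ∘ (inside ∷_)))

  ∑ˢ-mono-≤ : (∀ S → f S ≤ g S) → ∑ˢ f ≤ ∑ˢ g
  ∑ˢ-mono-≤ {zero}  f≤g = f≤g []
  ∑ˢ-mono-≤ {suc n} f≤g = ℕP.+-mono-≤ (∑ˢ-mono-≤ (f≤g ∘ (outside ∷_))) (∑ˢ-mono-≤ (f≤g ∘ (inside ∷_)))

  ∑ˢ-distrib-+ : (f g : Subset n → ℕ) → ∑ˢ (λ S → f S + g S) ≡ ∑ˢ f + ∑ˢ g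
  ∑ˢ-distrib-+ {zero}  f g = refl
  ∑ˢ-distrib-+ {suc n} f g = trans
    (cong₂ _+_ (∑ˢ-distrib-+ (f ∘ (outside ∷_)) (g ∘ (outside ∷_)))
               (∑ˢ-distrib-+ (f ∘ (inside ∷_)) (g ∘ (inside ∷_))))
    (interchange (∑ˢ (f ∘ (outside ∷_))) _ _ _)

  *-distribˡ-∑ˢ : ∀ c (f : Subset n → ℕ) → c * ∑ˢ f ≡ ∑ˢ (λ S → c * f S)
  *-distribˡ-∑ˢ {zero}  c f = refl
  *-distribˡ-∑ˢ {suc n} c f = trans (ℕP.*-distribˡ-+ c _ _)
    (cong₂ _+_ (*-distribˡ-∑ˢ c (f ∘ (outside ∷_))) (*-distribˡ-∑ˢ c (f ∘ (inside ∷_))))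

  *-distribʳ-∑ˢ : ∀ c (f : Subset n → ℕ) → ∑ˢ f * c ≡ ∑ˢ (λ S → f S * c)
  *-distribʳ-∑ˢ c f = trans (ℕP.*-comm (∑ˢ f) c)
    (trans (*-distribˡ-∑ˢ c f) (∑ˢ-cong (λ S → ℕP.*-comm c (f S))))

  ∑ˢ-zero : ∑ˢ {n} (λ _ → 0) ≡ 0
  ∑ˢ-zero {zero}  = refl
  ∑ˢ-zero {suc n} = cong₂ _+_ (∑ˢ-zero {n}) (∑ˢ-zero {n})

  ∑ˢ-∑-comm : (F : Subset n → Fin m → ℕ) → ∑ˢ (λ S → ∑[ u < m ] F S u) ≡ ∑[ u < m ] ∑ˢ (λ S → F S u)
  ∑ˢ-∑-comm {zero}  F = refl
  ∑ˢ-∑-comm {suc n} F = trans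
    (cong₂ _+_ (∑ˢ-∑-comm (F ∘ (outside ∷_))) (∑ˢ-∑-comm (F ∘ (inside ∷_))))
    (sym (∑-distrib-+ (λ u → ∑ˢ (λ S → F (outside ∷ S) u)) (λ u → ∑ˢ (λ S → F (inside ∷ S) u))))

  ∑ˢ-*-∑ˢ : (f g : Subset n → ℕ) → ∑ˢ f * ∑ˢ g ≡ ∑ˢ (λ C → ∑ˢ (λ D → f C * g D))
  ∑ˢ-*-∑ˢ f g = trans (*-distribʳ-∑ˢ (∑ˢ g) f) (∑ˢ-cong (λ C → *-distribˡ-∑ˢ (f C) g))

  2ab≤a²+b² : ∀ a b → 2 * (a * b) ≤ a * a + b * b
  2ab≤a²+b² a b = [ ordered , swapped ]′ (ℕP.≤-total a b)
    where
    ordered : ∀ {a b} → a ≤ b → 2 * (a * b) ≤ a * a + b * b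
    ordered {a} a≤b with o , refl ← ℕP.m≤n⇒∃[o]m+o≡n a≤b =
      subst (2 * (a * (a + o)) ≤_) (square-gap a o) (ℕP.m≤m+n _ (o * o))
      where
      square-gap : ∀ a o → 2 * (a * (a + o)) + o * o ≡ a * a + (a + o) * (a + o)
      square-gap = solve-∀
    swapped : b ≤ a → 2 * (a * b) ≤ a * a + b * b
    swapped b≤a = subst₂ _≤_ (cong (2 *_) (ℕP.*-comm b a)) (ℕP.+-comm (b * b) (a * a)) (ordered b≤a)

  cauchy-schwarz : (w d : Subset n → ℕ) →
    ∑ˢ (λ S → w S * d S) * ∑ˢ (λ S → w S * d S) ≤ ∑ˢ w * ∑ˢ (λ S → w S * (d S * d S))
  cauchy-schwarz {n} w d = ℕP.*-cancelˡ-≤ 2 (begin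
    2 * (X * X)
      ≡⟨ cong (2 *_) (∑ˢ-*-∑ˢ wd wd) ⟩
    2 * ∑ˢ (λ C → ∑ˢ (λ D → wd C * wd D))
      ≡⟨ trans (*-distribˡ-∑ˢ 2 (λ C → ∑ˢ (λ D → wd C * wd D)))
               (∑ˢ-cong (λ C → *-distribˡ-∑ˢ 2 (λ D → wd C * wd D))) ⟩
    ∑ˢ (λ C → ∑ˢ (λ D → 2 * (wd C * wd D)))
      ≤⟨ ∑ˢ-mono-≤ (λ C → ∑ˢ-mono-≤ (λ D → pairwise (w C) (w D) (d C) (d D))) ⟩
    ∑ˢ (λ C → ∑ˢ (λ D → w C * wdd D + wdd C * w D))
      ≡⟨ ∑ˢ-cong (λ C → ∑ˢ-distrib-+ (λ D → w C * wdd D) (λ D → wdd C * w D)) ⟩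
    ∑ˢ (λ C → ∑ˢ (λ D → w C * wdd D) + ∑ˢ (λ D → wdd C * w D))
      ≡⟨ ∑ˢ-distrib-+ (λ C → ∑ˢ (λ D → w C * wdd D)) (λ C → ∑ˢ (λ D → wdd C * w D)) ⟩
    ∑ˢ (λ C → ∑ˢ (λ D → w C * wdd D)) + ∑ˢ (λ C → ∑ˢ (λ D → wdd C * w D))
      ≡⟨ cong₂ _+_ (∑ˢ-*-∑ˢ w wdd) (∑ˢ-*-∑ˢ wdd w) ⟨
    P * Q + Q * P
      ≡⟨ double P Q ⟩
    2 * (P * Q) ∎)
    where
    open ℕP.≤-Reasoning
    wd wdd : Subset n → ℕ
    wd S = w S * d S
    wdd S = w S * (d S * d S)
    X = ∑ˢ wd
    P = ∑ˢ w
    Q = ∑ˢ wdd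
    double : ∀ p q → p * q + q * p ≡ 2 * (p * q)
    double = solve-∀
    pairwise : ∀ a b x y → 2 * ((a * x) * (b * y)) ≤ a * (b * (y * y)) + (a * (x * x)) * b
    pairwise a b x y = subst₂ _≤_ (lhs a b x y) (rhs a b x y) (ℕP.*-monoʳ-≤ (a * b) (2ab≤a²+b² x y))
      where
      lhs : ∀ a b x y → (a * b) * (2 * (x * y)) ≡ 2 * ((a * x) * (b * y))
      lhs = solve-∀
      rhs : ∀ a b x y → (a * b) * (x * x + y * y) ≡ a * (b * (y * y)) + (a * (x * x)) * b
      rhs = solve-∀

  𝟙 : Dec A → ℕ
  𝟙 a? = if does a? then 1 else 0

  𝟙-× : (a? : Dec A) (b? : Dec B) → 𝟙 (a? ×-dec b?) ≡ 𝟙 a? * 𝟙 b?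
  𝟙-× (yes _) (yes _) = refl
  𝟙-× (yes _) (no _)  = refl
  𝟙-× (no _)  _       = refl

  𝟙-cong : (A → B) → (B → A) → (a? : Dec A) (b? : Dec B) → 𝟙 a? ≡ 𝟙 b?
  𝟙-cong A→B B→A (yes a) (yes b) = refl
  𝟙-cong A→B B→A (yes a) (no ¬b) = contradiction (A→B a) ¬b
  𝟙-cong A→B B→A (no ¬a) (yes b) = contradiction (B→A b) ¬a
  𝟙-cong A→B B→A (no ¬a) (no ¬b) = refl

  𝟙≤1 : (a? : Dec A) → 𝟙 a? ≤ 1
  𝟙≤1 (yes _) = ℕP.≤-refl
  𝟙≤1 (no _)  = z≤n

  𝟙*-cong : (a? : Dec A) → (A → x ≡ y) → 𝟙 a? * x ≡ 𝟙 a? * y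
  𝟙*-cong (yes a) x≡y = cong (_+ 0) (x≡y a)
  𝟙*-cong (no _)  x≡y = refl

  𝟙*-mono-≤ : (a? : Dec A) → (A → x ≤ y) → 𝟙 a? * x ≤ 𝟙 a? * y
  𝟙*-mono-≤ (yes a) x≤y = ℕP.+-monoˡ-≤ 0 (x≤y a)
  𝟙*-mono-≤ (no _)  x≤y = z≤n

  𝟙-mono-≤ : (A → B) → (a? : Dec A) (b? : Dec B) → 𝟙 a? ≤ 𝟙 b?
  𝟙-mono-≤ A→B (yes a) (yes _) = ℕP.≤-refl
  𝟙-mono-≤ A→B (yes a) (no ¬b) = contradiction (A→B a) ¬b
  𝟙-mono-≤ A→B (no _)  b?      = z≤n

  ∑-mono-≤ : {f g : Fin n → ℕ} → (∀ i → f i ≤ g i) → ∑ f ≤ ∑ g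
  ∑-mono-≤ {zero}  f≤g = z≤n
  ∑-mono-≤ {suc n} f≤g = ℕP.+-mono-≤ (f≤g zero) (∑-mono-≤ (f≤g ∘ suc))

  ∑-1≡n : ∑[ i < n ] 1 ≡ n
  ∑-1≡n {zero}  = refl
  ∑-1≡n {suc n} = cong suc (∑-1≡n {n})

  ∑-𝟙≡0 : {P : Pred (Fin n) a} (P? : Decidable P) → (∀ i → ¬ P i) → ∑[ i < n ] 𝟙 (P? i) ≡ 0
  ∑-𝟙≡0 {zero}  P? ¬P = refl
  ∑-𝟙≡0 {suc n} P? ¬P with P? zero
  ... | yes p = contradiction p (¬P zero)
  ... | no _  = ∑-𝟙≡0 (P? ∘ suc) (¬P ∘ suc)

  ∑-𝟙≤1 : {P : Pred (Fin n) a} (P? : Decidable P) → (∀ {i j} → P i → P j → i ≡ j) → ∑[ i < n ] 𝟙 (P? i) ≤ 1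
  ∑-𝟙≤1 {zero}  P? unique = z≤n
  ∑-𝟙≤1 {suc n} P? unique with P? zero
  ... | yes p = ℕP.≤-reflexive (cong suc (∑-𝟙≡0 (P? ∘ suc) (λ i q → FinP.0≢1+n (unique p q))))
  ... | no _  = ∑-𝟙≤1 (P? ∘ suc) (λ p q → FinP.suc-injective (unique p q))

  ∑-𝟙≤n : {P : Pred (Fin n) a} (P? : Decidable P) → ∑[ i < n ] 𝟙 (P? i) ≤ n
  ∑-𝟙≤n {zero}  P? = z≤n
  ∑-𝟙≤n {suc n} P? = ℕP.+-mono-≤ (𝟙≤1 (P? zero)) (∑-𝟙≤n (P? ∘ suc))

  ∑-𝟙∈≡∣∣ : (S : Subset n) → ∑[ u < n ] 𝟙 (u ∈? S) ≡ ∣ S ∣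
  ∑-𝟙∈≡∣∣ []            = refl
  ∑-𝟙∈≡∣∣ (outside ∷ S) = ∑-𝟙∈≡∣∣ S
  ∑-𝟙∈≡∣∣ (inside ∷ S)  = cong suc (∑-𝟙∈≡∣∣ S)

  length-filter≡sum-𝟙 : {P : Pred A a} (P? : Decidable P) (xs : List A) →
    length (filter P? xs) ≡ sum (map (𝟙 ∘ P?) xs)
  length-filter≡sum-𝟙 P? []       = refl
  length-filter≡sum-𝟙 P? (x ∷ xs) with P? x
  ... | yes _ = cong suc (length-filter≡sum-𝟙 P? xs)
  ... | no _  = length-filter≡sum-𝟙 P? xs

  ∈-update⁺ : ∀ {b} → u ≢ v → u ∈ S → u ∈ S [ v ]≔ b
  ∈-update⁺ {u = u} {v} {S} u≢v = VecP.[]≔-minimal S u v u≢v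

  ∈-update⁻ : ∀ {b} → u ≢ v → u ∈ S [ v ]≔ b → u ∈ S
  ∈-update⁻ {u = u} {v} {S} u≢v u∈ =
    VecP.lookup⇒[]= u S (trans (sym (VecP.lookup∘update′ u≢v S _)) (VecP.[]=⇒lookup u∈))

  ∈-insert : u ∈ S [ u ]≔ inside
  ∈-insert {u = u} {S} = VecP.[]≔-updates S u

  ⊆-insert : S ⊆ S [ v ]≔ inside
  ⊆-insert {v = v} {x = u} u∈S with u FinP.≟ v
  ... | yes refl = ∈-insert
  ... | no u≢v   = ∈-update⁺ u≢v u∈S

  ∉⇒lookup≡outside : u ∉ S → lookup S u ≡ outside
  ∉⇒lookup≡outside {u = u} {S} u∉S with lookup S u in eq
  ... | inside  = contradiction (VecP.lookup⇒[]= u S eq) u∉S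
  ... | outside = refl

  remove-insert : u ∉ S → S [ u ]≔ inside [ u ]≔ outside ≡ S
  remove-insert {u = u} {S} u∉S = trans (VecP.[]≔-idempotent S u)
    (subst (λ b → S [ u ]≔ b ≡ S) (∉⇒lookup≡outside u∉S) (VecP.[]≔-lookup S u))

  ∣∣-insert : u ∉ S → ∣ S [ u ]≔ inside ∣ ≡ suc ∣ S ∣
  ∣∣-insert {u = zero}  {outside ∷ S} u∉S = refl
  ∣∣-insert {u = zero}  {inside ∷ S}  u∉S = contradiction here u∉S
  ∣∣-insert {u = suc u} {outside ∷ S} u∉S = ∣∣-insert (u∉S ∘ there)
  ∣∣-insert {u = suc u} {inside ∷ S}  u∉S = cong suc (∣∣-insert (u∉S ∘ there))

  ∑ˢ-∈-reindex : (u : Fin n) (h : Subset n → ℕ) →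
    ∑ˢ (λ S → 𝟙 (u ∈? S) * h S) ≡ ∑ˢ (λ C → 𝟙 (¬? (u ∈? C)) * h (C [ u ]≔ inside))
  ∑ˢ-∈-reindex {suc n} zero    h = ℕP.+-comm (∑ˢ {n} (λ _ → 0)) _
  ∑ˢ-∈-reindex         (suc u) h =
    cong₂ _+_ (∑ˢ-∈-reindex u (h ∘ (outside ∷_))) (∑ˢ-∈-reindex u (h ∘ (inside ∷_)))

  -- Cliques and their one-vertex extensions

  IsClique-⊆ : S ⊆ C → IsClique G C → IsClique G S
  IsClique-⊆ S⊆C clique i j i∈S j∈S = clique i j (S⊆C i∈S) (S⊆C j∈S)

  sizedClique? : (G : Graph n) (s : ℕ) (S : Subset n) → Dec (∣ S ∣ ≡ s × IsClique G S)
  sizedClique? G s S = (∣ S ∣ ℕ.≟ s) ×-dec isClique? G S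

  k≡∑ˢ : (s : ℕ) (G : Graph n) → k s G ≡ ∑ˢ (𝟙 ∘ sizedClique? G s)
  k≡∑ˢ {n} s G = trans (length-filter≡sum-𝟙 (sizedClique? G s) (allSubsets n))
                       (sum-map-allSubsets (𝟙 ∘ sizedClique? G s))

  Extends : Graph n → Subset n → Fin n → Set
  Extends G C u = u ∉ C × IsClique G (C [ u ]≔ inside)

  extends? : (G : Graph n) (C : Subset n) (u : Fin n) → Dec (Extends G C u)
  extends? G C u = ¬? (u ∈? C) ×-dec isClique? G (C [ u ]≔ inside)

  extensions : Graph n → Subset n → ℕ
  extensions {n} G C = ∑[ u < n ] 𝟙 (extends? G C u)

  𝟙-clique-insert : (G : Graph n) (t : ℕ) (C : Subset n) (u : Fin n) →
    𝟙 (¬? (u ∈? C)) * 𝟙 (sizedClique? G (suc t) (C [ u ]≔ inside)) ≡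
    𝟙 (sizedClique? G t C) * 𝟙 (extends? G C u)
  𝟙-clique-insert G t C u = begin
    𝟙 (¬? (u ∈? C)) * 𝟙 (sizedClique? G (suc t) (C [ u ]≔ inside))
      ≡⟨ 𝟙-× (¬? (u ∈? C)) (sizedClique? G (suc t) (C [ u ]≔ inside)) ⟨
    𝟙 (¬? (u ∈? C) ×-dec sizedClique? G (suc t) (C [ u ]≔ inside))
      ≡⟨ 𝟙-cong to from (¬? (u ∈? C) ×-dec sizedClique? G (suc t) (C [ u ]≔ inside))
                        (sizedClique? G t C ×-dec extends? G C u) ⟩
    𝟙 (sizedClique? G t C ×-dec extends? G C u)
      ≡⟨ 𝟙-× (sizedClique? G t C) (extends? G C u) ⟩
    𝟙 (sizedClique? G t C) * 𝟙 (extends? G C u) ∎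
    where
    open ≡-Reasoning
    to : u ∉ C × ∣ C [ u ]≔ inside ∣ ≡ suc t × IsClique G (C [ u ]≔ inside) →
         (∣ C ∣ ≡ t × IsClique G C) × Extends G C u
    to (u∉C , size , clique) =
      (ℕP.suc-injective (trans (sym (∣∣-insert u∉C)) size) , IsClique-⊆ {G = G} (⊆-insert {S = C} {v = u}) clique) ,
      (u∉C , clique)
    from : (∣ C ∣ ≡ t × IsClique G C) × Extends G C u →
           u ∉ C × ∣ C [ u ]≔ inside ∣ ≡ suc t × IsClique G (C [ u ]≔ inside)
    from ((size , _) , (u∉C , clique)) = u∉C , trans (∣∣-insert u∉C) (cong suc size) , clique

  -- Both sides sum g over the pairs (t-clique C, vertex u extending C), the left one
  -- written as pairs ((t+1)-clique S, u ∈ S) with C = S - u.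
  double-count : (G : Graph n) (t : ℕ) (g : Subset n → Fin n → ℕ) →
    ∑ˢ (λ S → 𝟙 (sizedClique? G (suc t) S) * ∑[ u < n ] (𝟙 (u ∈? S) * g (S [ u ]≔ outside) u)) ≡
    ∑ˢ (λ C → 𝟙 (sizedClique? G t C) * ∑[ u < n ] (𝟙 (extends? G C u) * g C u))
  double-count {n} G t g = begin
    ∑ˢ (λ S → W′ S * ∑[ u < n ] deletion S u)
      ≡⟨ ∑ˢ-cong (λ S → *-distribˡ-sum (W′ S) (deletion S)) ⟩
    ∑ˢ (λ S → ∑[ u < n ] (W′ S * deletion S u))
      ≡⟨ ∑ˢ-∑-comm (λ S u → W′ S * deletion S u) ⟩
    ∑[ u < n ] ∑ˢ (λ S → W′ S * (𝟙 (u ∈? S) * g (S [ u ]≔ outside) u))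
      ≡⟨ sum-cong-≗ {n} (λ u → ∑ˢ-cong (λ S → x∙yz≈y∙xz (W′ S) (𝟙 (u ∈? S)) (g (S [ u ]≔ outside) u))) ⟩
    ∑[ u < n ] ∑ˢ (λ S → 𝟙 (u ∈? S) * (W′ S * g (S [ u ]≔ outside) u))
      ≡⟨ sum-cong-≗ {n} (λ u → ∑ˢ-∈-reindex u (λ S → W′ S * g (S [ u ]≔ outside) u)) ⟩
    ∑[ u < n ] ∑ˢ (λ C → 𝟙 (¬? (u ∈? C)) * (W′ (C [ u ]≔ inside) * g (C [ u ]≔ inside [ u ]≔ outside) u))
      ≡⟨ sum-cong-≗ {n} (λ u → ∑ˢ-cong (λ C → inserted-term C u)) ⟩
    ∑[ u < n ] ∑ˢ (λ C → W C * extension C u)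
      ≡⟨ ∑ˢ-∑-comm (λ C u → W C * extension C u) ⟨
    ∑ˢ (λ C → ∑[ u < n ] (W C * extension C u))
      ≡⟨ ∑ˢ-cong (λ C → *-distribˡ-sum (W C) (extension C)) ⟨
    ∑ˢ (λ C → W C * ∑[ u < n ] extension C u) ∎
    where
    open ≡-Reasoning
    W W′ : Subset n → ℕ
    W  = 𝟙 ∘ sizedClique? G t
    W′ = 𝟙 ∘ sizedClique? G (suc t)
    deletion extension : Subset n → Fin n → ℕ
    deletion S u = 𝟙 (u ∈? S) * g (S [ u ]≔ outside) u
    extension C u = 𝟙 (extends? G C u) * g C u
    inserted-term : ∀ C u →
      𝟙 (¬? (u ∈? C)) * (W′ (C [ u ]≔ inside) * g (C [ u ]≔ inside [ u ]≔ outside) u) ≡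
      W C * (𝟙 (extends? G C u) * g C u)
    inserted-term C u = begin
      𝟙 (¬? (u ∈? C)) * (W′ (C [ u ]≔ inside) * g (C [ u ]≔ inside [ u ]≔ outside) u)
        ≡⟨ 𝟙*-cong (¬? (u ∈? C)) (λ u∉C → cong (λ D → W′ (C [ u ]≔ inside) * g D u) (remove-insert u∉C)) ⟩
      𝟙 (¬? (u ∈? C)) * (W′ (C [ u ]≔ inside) * g C u)
        ≡⟨ ℕP.*-assoc (𝟙 (¬? (u ∈? C))) _ _ ⟨
      𝟙 (¬? (u ∈? C)) * W′ (C [ u ]≔ inside) * g C u
        ≡⟨ cong (_* g C u) (𝟙-clique-insert G t C u) ⟩
      W C * 𝟙 (extends? G C u) * g C u
        ≡⟨ ℕP.*-assoc (W C) _ _ ⟩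
      W C * (𝟙 (extends? G C u) * g C u) ∎

  ∑-extensions : (G : Graph n) (t : ℕ) →
    ∑ˢ (λ C → 𝟙 (sizedClique? G t C) * extensions G C) ≡ suc t * k (suc t) G
  ∑-extensions {n} G t = begin
    ∑ˢ (λ C → W C * extensions G C)
      ≡⟨ ∑ˢ-cong (λ C → cong (W C *_) (sum-cong-≗ {n} (λ u → sym (ℕP.*-identityʳ (𝟙 (extends? G C u)))))) ⟩
    ∑ˢ (λ C → W C * ∑[ u < n ] (𝟙 (extends? G C u) * 1))
      ≡⟨ double-count G t (λ _ _ → 1) ⟨
    ∑ˢ (λ S → W′ S * ∑[ u < n ] (𝟙 (u ∈? S) * 1))
      ≡⟨ ∑ˢ-cong (λ S → cong (W′ S *_) (trans (sum-cong-≗ {n} (λ u → ℕP.*-identityʳ (𝟙 (u ∈? S)))) (∑-𝟙∈≡∣∣ S))) ⟩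
    ∑ˢ (λ S → W′ S * ∣ S ∣)
      ≡⟨ ∑ˢ-cong (λ S → 𝟙*-cong (sizedClique? G (suc t) S) proj₁) ⟩
    ∑ˢ (λ S → W′ S * suc t)
      ≡⟨ *-distribʳ-∑ˢ (suc t) W′ ⟨
    ∑ˢ W′ * suc t
      ≡⟨ ℕP.*-comm (∑ˢ W′) (suc t) ⟩
    suc t * ∑ˢ W′
      ≡⟨ cong (suc t *_) (k≡∑ˢ (suc t) G) ⟨
    suc t * k (suc t) G ∎
    where
    open ≡-Reasoning
    W W′ : Subset n → ℕ
    W  = 𝟙 ∘ sizedClique? G t
    W′ = 𝟙 ∘ sizedClique? G (suc t)

  extends-of-two-deletions : {u₁ u₂ : Fin n} → IsClique G S → u₁ ∈ S → u₂ ∈ S → u₁ ≢ u₂ →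
    Extends G (S [ u₁ ]≔ outside) v → Extends G (S [ u₂ ]≔ outside) v → Extends G S v
  extends-of-two-deletions {G = G} {S = S} {v = v} {u₁} {u₂}
    clique u₁∈S u₂∈S u₁≢u₂ (v∉S₁ , clique₁) (v∉S₂ , clique₂) = v∉S , clique⁺
    where
    v∉S : v ∉ S
    v∉S v∈S with v FinP.≟ u₁
    ... | yes refl = v∉S₂ (∈-update⁺ u₁≢u₂ v∈S)
    ... | no v≢u₁  = v∉S₁ (∈-update⁺ v≢u₁ v∈S)
    moved : ∀ {u x} → x ≢ u → x ∈ S [ v ]≔ inside → x ∈ S [ u ]≔ outside [ v ]≔ inside
    moved {u} {x} x≢u x∈ with x FinP.≟ v
    ... | yes refl = ∈-insert
    ... | no x≢v   = ∈-update⁺ x≢v (∈-update⁺ x≢u (∈-update⁻ x≢v x∈))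
    -- A pair avoiding u₁ lies in (S - u₁) + v, a pair avoiding u₂ in (S - u₂) + v,
    -- and the only other pair, {u₁, u₂}, lies in S.
    clique⁺ : IsClique G (S [ v ]≔ inside)
    clique⁺ i j i∈ j∈ i≢j with i FinP.≟ u₁ | j FinP.≟ u₁ | i FinP.≟ u₂ | j FinP.≟ u₂
    ... | no i≢u₁  | no j≢u₁  | _        | _        = clique₁ i j (moved i≢u₁ i∈) (moved j≢u₁ j∈) i≢j
    ... | _        | _        | no i≢u₂  | no j≢u₂  = clique₂ i j (moved i≢u₂ i∈) (moved j≢u₂ j∈) i≢j
    ... | yes refl | _        | yes refl | _        = contradiction refl u₁≢u₂
    ... | _        | yes refl | _        | yes refl = contradiction refl u₁≢u₂
    ... | yes refl | _        | _        | yes refl = clique i j u₁∈S u₂∈S i≢j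
    ... | _        | yes refl | yes refl | _        = clique i j u₂∈S u₁∈S i≢j

  deletions-extended-by : IsClique G S → ∣ S ∣ ≡ suc t → (v : Fin n) →
    ∑[ u < n ] (𝟙 (u ∈? S) * 𝟙 (extends? G (S [ u ]≔ outside) v)) ≤ 1 + t * 𝟙 (extends? G S v)
  deletions-extended-by {n = n} {G} {S} {t} clique size v = by-cases (extends? G S v)
    where
    open ℕP.≤-Reasoning
    deletions : ℕ
    deletions = ∑[ u < n ] (𝟙 (u ∈? S) * 𝟙 (extends? G (S [ u ]≔ outside) v))
    unique : ¬ Extends G S v → ∀ {u₁ u₂} →
             u₁ ∈ S × Extends G (S [ u₁ ]≔ outside) v → u₂ ∈ S × Extends G (S [ u₂ ]≔ outside) v → u₁ ≡ u₂
    unique ¬extends {u₁} {u₂} (u₁∈S , extends₁) (u₂∈S , extends₂) = decidable-stable (u₁ FinP.≟ u₂) λ u₁≢u₂ →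
      ¬extends (extends-of-two-deletions {G = G} clique u₁∈S u₂∈S u₁≢u₂ extends₁ extends₂)
    by-cases : (e? : Dec (Extends G S v)) → deletions ≤ 1 + t * 𝟙 e?
    by-cases (yes _) = begin
      deletions
        ≤⟨ ∑-mono-≤ (λ u → ℕP.*-monoʳ-≤ (𝟙 (u ∈? S)) (𝟙≤1 (extends? G (S [ u ]≔ outside) v))) ⟩
      ∑[ u < n ] (𝟙 (u ∈? S) * 1)
        ≡⟨ sum-cong-≗ {n} (λ u → ℕP.*-identityʳ (𝟙 (u ∈? S))) ⟩
      ∑[ u < n ] 𝟙 (u ∈? S)
        ≡⟨ trans (∑-𝟙∈≡∣∣ S) size ⟩
      suc t
        ≡⟨ cong suc (ℕP.*-identityʳ t) ⟨
      1 + t * 1 ∎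
    by-cases (no ¬extends) = begin
      deletions
        ≡⟨ sum-cong-≗ {n} (λ u → 𝟙-× (u ∈? S) (extends? G (S [ u ]≔ outside) v)) ⟨
      ∑[ u < n ] 𝟙 (u ∈? S ×-dec extends? G (S [ u ]≔ outside) v)
        ≤⟨ ∑-𝟙≤1 (λ u → u ∈? S ×-dec extends? G (S [ u ]≔ outside) v) (unique ¬extends) ⟩
      1
        ≡⟨ cong suc (ℕP.*-zeroʳ t) ⟨
      1 + t * 0 ∎

  ∑-extensions-of-deletions : IsClique G S → ∣ S ∣ ≡ suc t →
    ∑[ u < n ] (𝟙 (u ∈? S) * extensions G (S [ u ]≔ outside)) ≤ n + t * extensions G S
  ∑-extensions-of-deletions {n = n} {G = G} {S = S} {t = t} clique size = begin
    ∑[ u < n ] (𝟙 (u ∈? S) * extensions G (S [ u ]≔ outside))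
      ≡⟨ sum-cong-≗ {n} (λ u → *-distribˡ-sum (𝟙 (u ∈? S)) (𝟙 ∘ extends? G (S [ u ]≔ outside))) ⟩
    ∑[ u < n ] ∑[ v < n ] (𝟙 (u ∈? S) * 𝟙 (extends? G (S [ u ]≔ outside) v))
      ≡⟨ ∑-comm (λ u v → 𝟙 (u ∈? S) * 𝟙 (extends? G (S [ u ]≔ outside) v)) ⟩
    ∑[ v < n ] ∑[ u < n ] (𝟙 (u ∈? S) * 𝟙 (extends? G (S [ u ]≔ outside) v))
      ≤⟨ ∑-mono-≤ (deletions-extended-by {G = G} clique size) ⟩
    ∑[ v < n ] (1 + t * 𝟙 (extends? G S v))
      ≡⟨ ∑-distrib-+ (λ _ → 1) (λ v → t * 𝟙 (extends? G S v)) ⟩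
    ∑[ v < n ] 1 + ∑[ v < n ] (t * 𝟙 (extends? G S v))
      ≡⟨ cong₂ _+_ (∑-1≡n {n}) (sym (*-distribˡ-sum t (𝟙 ∘ extends? G S))) ⟩
    n + t * extensions G S ∎
    where open ℕP.≤-Reasoning

  ∑-extensions² : (G : Graph n) (t : ℕ) →
    ∑ˢ (λ C → 𝟙 (sizedClique? G t C) * (extensions G C * extensions G C)) ≤
    n * k (suc t) G + t * (suc (suc t) * k (suc (suc t)) G)
  ∑-extensions² {n} G t = begin
    ∑ˢ (λ C → W C * (extensions G C * extensions G C))
      ≡⟨ ∑ˢ-cong (λ C → cong (W C *_) (*-distribʳ-sum (extensions G C) (𝟙 ∘ extends? G C))) ⟩
    ∑ˢ (λ C → W C * ∑[ u < n ] (𝟙 (extends? G C u) * extensions G C))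
      ≡⟨ double-count G t (λ C _ → extensions G C) ⟨
    ∑ˢ (λ S → W′ S * ∑[ u < n ] (𝟙 (u ∈? S) * extensions G (S [ u ]≔ outside)))
      ≤⟨ ∑ˢ-mono-≤ (λ S → 𝟙*-mono-≤ (sizedClique? G (suc t) S) λ (size , clique) →
           ∑-extensions-of-deletions {G = G} clique size) ⟩
    ∑ˢ (λ S → W′ S * (n + t * extensions G S))
      ≡⟨ ∑ˢ-cong (λ S → ℕP.*-distribˡ-+ (W′ S) n (t * extensions G S)) ⟩
    ∑ˢ (λ S → W′ S * n + W′ S * (t * extensions G S))
      ≡⟨ ∑ˢ-distrib-+ (λ S → W′ S * n) (λ S → W′ S * (t * extensions G S)) ⟩
    ∑ˢ (λ S → W′ S * n) + ∑ˢ (λ S → W′ S * (t * extensions G S))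
      ≡⟨ cong₂ _+_ (*-distribʳ-∑ˢ n W′) (∑ˢ-cong (λ S → x∙yz≈y∙xz t (W′ S) (extensions G S))) ⟨
    ∑ˢ W′ * n + ∑ˢ (λ S → t * (W′ S * extensions G S))
      ≡⟨ cong₂ _+_ (ℕP.*-comm (∑ˢ W′) n) (sym (*-distribˡ-∑ˢ t (λ S → W′ S * extensions G S))) ⟩
    n * ∑ˢ W′ + t * ∑ˢ (λ S → W′ S * extensions G S)
      ≡⟨ cong₂ (λ a b → n * a + t * b) (sym (k≡∑ˢ (suc t) G)) (∑-extensions G (suc t)) ⟩
    n * k (suc t) G + t * (suc (suc t) * k (suc (suc t)) G) ∎
    where
    open ℕP.≤-Reasoning
    W W′ : Subset n → ℕ
    W  = 𝟙 ∘ sizedClique? G t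
    W′ = 𝟙 ∘ sizedClique? G (suc t)

  moon-moser : (G : Graph n) (t : ℕ) →
    (suc t * k (suc t) G) * (suc t * k (suc t) G) ≤
    k t G * (n * k (suc t) G + t * (suc (suc t) * k (suc (suc t)) G))
  moon-moser {n} G t = begin
    (suc t * k (suc t) G) * (suc t * k (suc t) G)
      ≡⟨ cong₂ _*_ (∑-extensions G t) (∑-extensions G t) ⟨
    ∑ˢ (λ C → W C * extensions G C) * ∑ˢ (λ C → W C * extensions G C)
      ≤⟨ cauchy-schwarz W (extensions G) ⟩
    ∑ˢ W * ∑ˢ (λ C → W C * (extensions G C * extensions G C))
      ≤⟨ ℕP.*-monoʳ-≤ (∑ˢ W) (∑-extensions² G t) ⟩
    ∑ˢ W * (n * k (suc t) G + t * (suc (suc t) * k (suc (suc t)) G))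
      ≡⟨ cong (_* (n * k (suc t) G + t * (suc (suc t) * k (suc (suc t)) G))) (k≡∑ˢ t G) ⟨
    k t G * (n * k (suc t) G + t * (suc (suc t) * k (suc (suc t)) G)) ∎
    where
    open ℕP.≤-Reasoning
    W : Subset n → ℕ
    W = 𝟙 ∘ sizedClique? G t

  moon-moser-scaled : (G : Graph n) (t : ℕ) →
    (t * suc t) * ((suc t * k (suc t) G) * (suc t * k (suc t) G)) ≤
    (t * k t G) * (n * (suc t * k (suc t) G) + (t * suc t) * (suc (suc t) * k (suc (suc t)) G))
  moon-moser-scaled {n} G t = subst ((t * suc t) * ((suc t * k (suc t) G) * (suc t * k (suc t) G)) ≤_)
    (rearrange t (k t G) n (k (suc t) G) (k (suc (suc t)) G))
    (ℕP.*-monoʳ-≤ (t * suc t) (moon-moser G t))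
    where
    rearrange : ∀ t k₀ n k₁ k₂ →
      (t * suc t) * (k₀ * (n * k₁ + t * (suc (suc t) * k₂))) ≡
      (t * k₀) * (n * (suc t * k₁) + (t * suc t) * (suc (suc t) * k₂))
    rearrange = solve-∀

  ∑ˢ-𝟙-empty : ∑ˢ {n} (λ S → 𝟙 (∣ S ∣ ℕ.≟ 0)) ≡ 1
  ∑ˢ-𝟙-empty {zero}  = refl
  ∑ˢ-𝟙-empty {suc n} = cong₂ _+_ (∑ˢ-𝟙-empty {n}) (∑ˢ-zero {n})

  k₀≤1 : (G : Graph n) → k 0 G ≤ 1
  k₀≤1 {n} G = begin
    k 0 G                          ≡⟨ k≡∑ˢ 0 G ⟩
    ∑ˢ (𝟙 ∘ sizedClique? G 0)      ≤⟨ ∑ˢ-mono-≤ (λ S → 𝟙-mono-≤ proj₁ (sizedClique? G 0 S) (∣ S ∣ ℕ.≟ 0)) ⟩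
    ∑ˢ {n} (λ S → 𝟙 (∣ S ∣ ℕ.≟ 0)) ≡⟨ ∑ˢ-𝟙-empty {n} ⟩
    1                              ∎
    where open ℕP.≤-Reasoning

  k₁≤n : (G : Graph n) → k 1 G ≤ n
  k₁≤n {n} G = begin
    k 1 G                              ≡⟨ ℕP.*-identityˡ (k 1 G) ⟨
    1 * k 1 G                          ≡⟨ ∑-extensions G 0 ⟨
    ∑ˢ (λ C → W₀ C * extensions G C)   ≤⟨ ∑ˢ-mono-≤ (λ C → ℕP.*-monoʳ-≤ (W₀ C) (∑-𝟙≤n (extends? G C))) ⟩
    ∑ˢ (λ C → W₀ C * n)                ≡⟨ *-distribʳ-∑ˢ n W₀ ⟨
    ∑ˢ W₀ * n                          ≡⟨ cong (_* n) (k≡∑ˢ 0 G) ⟨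
    k 0 G * n                          ≤⟨ ℕP.*-monoˡ-≤ n (k₀≤1 G) ⟩
    1 * n                              ≡⟨ ℕP.*-identityˡ n ⟩
    n                                  ∎
    where
    open ℕP.≤-Reasoning
    W₀ : Subset n → ℕ
    W₀ = 𝟙 ∘ sizedClique? G 0

module RationalBounds where

  open import Data.Integer as ℤ using (ℤ; +_)
  import Data.Integer.Properties as ℤP
  open import Data.Integer.Tactic.RingSolver using () renaming (solve-∀ to ℤ-solve-∀)
  open import Data.Nat as ℕ using (ℕ; zero; suc; z≤n; s≤s; ≤′-refl; ≤′-step)
  import Data.Nat.Properties as ℕP
  open import Data.Rational as ℚ using (ℚ; 0ℚ; 1ℚ; _+_; _*_; -_; _≤_; _<_; toℚᵘ)
  import Data.Rational.Properties as ℚP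
  open import Data.Rational.Solver using (module +-*-Solver)
  open +-*-Solver using (solve; _:+_; _:*_; :-_; con; _:=_)
  open import Data.Rational.Unnormalised as ℚᵘ using (mkℚᵘ; *≡*; *≤*)
  import Data.Rational.Unnormalised.Properties as ℚᵘP
  open import Data.Sum using (_⊎_; inj₁; inj₂)
  open import Relation.Binary.Definitions using (tri<; tri≈; tri>)
  open import Relation.Binary.PropositionalEquality
  open import Relation.Nullary using (contradiction)

  -- ι m reduces to fromℤ (+ m).
  fromℤ : ℤ → ℚ
  fromℤ i = i ℚ./ 1

  private
    toℚᵘ-fromℤ : ∀ i → toℚᵘ (fromℤ i) ℚᵘ.≃ mkℚᵘ i 0
    toℚᵘ-fromℤ i = ℚP.toℚᵘ-fromℚᵘ (mkℚᵘ i 0)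

  fromℤ-+ : ∀ i j → fromℤ (i ℤ.+ j) ≡ fromℤ i + fromℤ j
  fromℤ-+ i j = ℚP.toℚᵘ-injective (begin
    toℚᵘ (fromℤ (i ℤ.+ j))          ≈⟨ toℚᵘ-fromℤ (i ℤ.+ j) ⟩
    mkℚᵘ (i ℤ.+ j) 0                ≈⟨ *≡* (identity i j) ⟩
    mkℚᵘ i 0 ℚᵘ.+ mkℚᵘ j 0          ≈⟨ ℚᵘP.+-cong (toℚᵘ-fromℤ i) (toℚᵘ-fromℤ j) ⟨
    toℚᵘ (fromℤ i) ℚᵘ.+ toℚᵘ (fromℤ j) ≈⟨ ℚP.toℚᵘ-homo-+ (fromℤ i) (fromℤ j) ⟨
    toℚᵘ (fromℤ i + fromℤ j)        ∎)
    where
    open ℚᵘP.≃-Reasoning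
    identity : ∀ i j → (i ℤ.+ j) ℤ.* + 1 ≡ (i ℤ.* + 1 ℤ.+ j ℤ.* + 1) ℤ.* + 1
    identity = ℤ-solve-∀

  fromℤ-* : ∀ i j → fromℤ (i ℤ.* j) ≡ fromℤ i * fromℤ j
  fromℤ-* i j = ℚP.toℚᵘ-injective (begin
    toℚᵘ (fromℤ (i ℤ.* j))          ≈⟨ toℚᵘ-fromℤ (i ℤ.* j) ⟩
    mkℚᵘ (i ℤ.* j) 0                ≈⟨ ℚᵘP.*-cong (toℚᵘ-fromℤ i) (toℚᵘ-fromℤ j) ⟨
    toℚᵘ (fromℤ i) ℚᵘ.* toℚᵘ (fromℤ j) ≈⟨ ℚP.toℚᵘ-homo-* (fromℤ i) (fromℤ j) ⟨
    toℚᵘ (fromℤ i * fromℤ j)        ∎)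
    where open ℚᵘP.≃-Reasoning

  fromℤ-mono-≤ : ∀ {i j} → i ℤ.≤ j → fromℤ i ≤ fromℤ j
  fromℤ-mono-≤ {i} {j} i≤j = ℚP.toℚᵘ-cancel-≤
    (ℚᵘP.≤-respʳ-≃ (ℚᵘP.≃-sym (toℚᵘ-fromℤ j)) (ℚᵘP.≤-respˡ-≃ (ℚᵘP.≃-sym (toℚᵘ-fromℤ i))
      (*≤* (ℤP.*-monoʳ-≤-nonNeg (+ 1) i≤j))))

  ι-+ : ∀ a b → ι (a ℕ.+ b) ≡ ι a + ι b
  ι-+ a b = trans (cong fromℤ (ℤP.pos-+ a b)) (fromℤ-+ (+ a) (+ b))

  ι-* : ∀ a b → ι (a ℕ.* b) ≡ ι a * ι b
  ι-* a b = trans (cong fromℤ (ℤP.pos-* a b)) (fromℤ-* (+ a) (+ b))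

  ι-mono-≤ : ∀ {a b} → a ℕ.≤ b → ι a ≤ ι b
  ι-mono-≤ a≤b = fromℤ-mono-≤ (ℤ.+≤+ a≤b)

  0≤ι : ∀ a → 0ℚ ≤ ι a
  0≤ι a = ι-mono-≤ {0} {a} z≤n

  0<ι : ∀ a → 0ℚ < ι (suc a)
  0<ι a = ℚP.positive⁻¹ (ι (suc a)) {{ℚP.normalize-pos (suc a) 1}}

  /ℚ-*-cancel : ∀ i d → (i /ℚ suc d) * ι (suc d) ≡ fromℤ i
  /ℚ-*-cancel i d = ℚP.toℚᵘ-injective (begin
    toℚᵘ ((i ℚ./ suc d) * ι (suc d))                ≈⟨ ℚP.toℚᵘ-homo-* (i ℚ./ suc d) (ι (suc d)) ⟩
    toℚᵘ (i ℚ./ suc d) ℚᵘ.* toℚᵘ (ι (suc d))         ≈⟨ ℚᵘP.*-cong (ℚP.toℚᵘ-fromℚᵘ (mkℚᵘ i d)) (toℚᵘ-fromℤ (+ suc d)) ⟩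
    mkℚᵘ i d ℚᵘ.* mkℚᵘ (+ suc d) 0                  ≈⟨ *≡* (identity i (+ suc d)) ⟩
    mkℚᵘ i 0                                        ≈⟨ toℚᵘ-fromℤ i ⟨
    toℚᵘ (fromℤ i)                                  ∎)
    where
    open ℚᵘP.≃-Reasoning
    identity : ∀ i d → (i ℤ.* d) ℤ.* + 1 ≡ i ℤ.* (d ℤ.* + 1)
    identity = ℤ-solve-∀

  private variable
    x x′ y y′ z : ℚ

  nonneg-*-monoˡ-≤ : 0ℚ ≤ z → x ≤ y → z * x ≤ z * y
  nonneg-*-monoˡ-≤ {z} 0≤z = ℚP.*-monoˡ-≤-nonNeg z {{ℚ.nonNegative 0≤z}}

  pos-*-cancelˡ-≤ : 0ℚ < z → z * x ≤ z * y → x ≤ y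
  pos-*-cancelˡ-≤ {z} 0<z = ℚP.*-cancelˡ-≤-pos z {{ℚ.positive 0<z}}

  pos-*-cancelʳ-≤ : 0ℚ < z → x * z ≤ y * z → x ≤ y
  pos-*-cancelʳ-≤ {z} 0<z = ℚP.*-cancelʳ-≤-pos z {{ℚ.positive 0<z}}

  pos-*-cancelˡ-≡ : 0ℚ < z → z * x ≡ z * y → x ≡ y
  pos-*-cancelˡ-≡ 0<z zx≡zy =
    ℚP.≤-antisym (pos-*-cancelˡ-≤ 0<z (ℚP.≤-reflexive zx≡zy)) (pos-*-cancelˡ-≤ 0<z (ℚP.≤-reflexive (sym zx≡zy)))

  pos-*-cancelʳ-≡ : 0ℚ < z → x * z ≡ y * z → x ≡ y
  pos-*-cancelʳ-≡ {z} {x} {y} 0<z xz≡yz =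
    pos-*-cancelˡ-≡ 0<z (trans (ℚP.*-comm z x) (trans xz≡yz (ℚP.*-comm y z)))

  +-cancelʳ-≤ : x + z ≤ y + z → x ≤ y
  +-cancelʳ-≤ {x} {z} {y} x+z≤y+z = subst₂ _≤_ (cancel x z) (cancel y z) (ℚP.+-monoˡ-≤ (- z) x+z≤y+z)
    where
    cancel : ∀ x z → x + z + - z ≡ x
    cancel = solve 2 (λ x z → x :+ z :+ :- z := x) refl

  x≤x+y : 0ℚ ≤ y → x ≤ x + y
  x≤x+y {y} {x} 0≤y = subst (_≤ x + y) (ℚP.+-identityʳ x) (ℚP.+-monoʳ-≤ x 0≤y)

  nonneg-*-nonneg : 0ℚ ≤ x → 0ℚ ≤ y → 0ℚ ≤ x * y
  nonneg-*-nonneg {x} {y} 0≤x 0≤y = subst (_≤ x * y) (ℚP.*-zeroʳ x) (nonneg-*-monoˡ-≤ 0≤x 0≤y)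

  nonneg-*-mono-≤ : 0ℚ ≤ x → x ≤ x′ → 0ℚ ≤ y → y ≤ y′ → x * y ≤ x′ * y′
  nonneg-*-mono-≤ {y′ = y′} 0≤x x≤x′ 0≤y y≤y′ = ℚP.≤-trans (nonneg-*-monoˡ-≤ 0≤x y≤y′)
    (ℚP.*-monoʳ-≤-nonNeg y′ {{ℚ.nonNegative (ℚP.≤-trans 0≤y y≤y′)}} x≤x′)

  nonneg⇒≡0⊎pos : 0ℚ ≤ x → x ≡ 0ℚ ⊎ 0ℚ < x
  nonneg⇒≡0⊎pos {x} 0≤x with ℚP.<-cmp 0ℚ x
  ... | tri< 0<x _ _ = inj₂ 0<x
  ... | tri≈ _ 0≡x _ = inj₁ (sym 0≡x)
  ... | tri> _ _ x<0 = contradiction (ℚP.<-≤-trans x<0 0≤x) (ℚP.<-irrefl refl)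

  square≤0⇒≡0 : 0ℚ ≤ x → x * x ≤ 0ℚ → x ≡ 0ℚ
  square≤0⇒≡0 {x} 0≤x x²≤0 with nonneg⇒≡0⊎pos 0≤x
  ... | inj₁ x≡0 = x≡0
  ... | inj₂ 0<x = contradiction (ℚP.<-≤-trans (ℚP.*-monoʳ-<-pos x {{ℚ.positive 0<x}} 0<x) x²≤0)
                                 (ℚP.<-irrefl (ℚP.*-zeroʳ x))

  nonneg-^ℚ : ∀ m → 0ℚ ≤ x → 0ℚ ≤ x ^ℚ m
  nonneg-^ℚ zero    0≤x = ℚP.<⇒≤ (0<ι 0)
  nonneg-^ℚ (suc m) 0≤x = nonneg-*-nonneg 0≤x (nonneg-^ℚ m 0≤x)

  ^ℚ-distribʳ-* : ∀ x y m → (x * y) ^ℚ m ≡ x ^ℚ m * y ^ℚ m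
  ^ℚ-distribʳ-* x y zero    = refl
  ^ℚ-distribʳ-* x y (suc m) = trans (cong (x * y *_) (^ℚ-distribʳ-* x y m)) (interchange x y (x ^ℚ m) (y ^ℚ m))
    where
    interchange : ∀ a b c d → a * b * (c * d) ≡ a * c * (b * d)
    interchange = solve 4 (λ a b c d → a :* b :* (c :* d) := a :* c :* (b :* d)) refl

  private
    restrict : ∀ {P : ℕ → Set} {m} → (∀ {t} → 1 ℕ.≤ t → t ℕ.≤ suc m → P t) → ∀ {t} → 1 ℕ.≤ t → t ℕ.≤ m → P t
    restrict P 1≤t t≤m = P 1≤t (ℕP.m≤n⇒m≤1+n t≤m)

  prod1to-nonneg : ∀ m {f} → (∀ {t} → 1 ℕ.≤ t → t ℕ.≤ m → 0ℚ ≤ f t) → 0ℚ ≤ prod1to m f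
  prod1to-nonneg zero    0≤f = ℚP.<⇒≤ (0<ι 0)
  prod1to-nonneg (suc m) 0≤f = nonneg-*-nonneg (prod1to-nonneg m (restrict 0≤f)) (0≤f (s≤s z≤n) ℕP.≤-refl)

  prod1to-mono-≤ : ∀ m {f g} → (∀ {t} → 1 ℕ.≤ t → t ℕ.≤ m → 0ℚ ≤ f t) →
    (∀ {t} → 1 ℕ.≤ t → t ℕ.≤ m → f t ≤ g t) → prod1to m f ≤ prod1to m g
  prod1to-mono-≤ zero    0≤f f≤g = ℚP.≤-refl
  prod1to-mono-≤ (suc m) 0≤f f≤g = nonneg-*-mono-≤
    (prod1to-nonneg m (restrict 0≤f)) (prod1to-mono-≤ m (restrict 0≤f) (restrict f≤g))
    (0≤f (s≤s z≤n) ℕP.≤-refl) (f≤g (s≤s z≤n) ℕP.≤-refl)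

  module Propagation
    (N α : ℚ) (r : ℕ) (b c D : ℕ → ℚ)
    (0≤N : 0ℚ ≤ N) (0≤α : 0ℚ ≤ α) (0≤b : ∀ t → 0ℚ ≤ b t) (b₁≤N : b 1 ≤ N)
    (0<D : ∀ {t} → 1 ℕ.≤ t → 0ℚ < D t)
    (0≤c : ∀ {t} → 1 ℕ.≤ t → t ℕ.≤ r → 0ℚ ≤ c t)
    (c-step : ∀ {t} → 1 ℕ.≤ t → t ℕ.< r → D t * c t ≡ D t * c (suc t) + 1ℚ)
    (moon-moser : ∀ t → D t * (b (suc t) * b (suc t)) ≤ b t * (N * b (suc t) + D t * b (suc (suc t))))
    where

    open import Data.Product using (_×_; _,_; proj₁; proj₂)
    open import Function using (_∘_)
    open import Relation.Nullary using (¬_; yes; no)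

    factor : ℕ → ℚ
    factor t = c t + α

    -- For c t = (r - t) / (r t) and α = 0 this is the value of b (m + 1) on the balanced
    -- complete r-partite graph with N vertices.
    extremal : ℕ → ℚ
    extremal m = N ^ℚ suc m * prod1to m factor

    Grows : ℕ → Set
    Grows t = factor t * (N * b t) ≤ b (suc t)

    0≤factor : ∀ {t} → 1 ℕ.≤ t → t ℕ.≤ r → 0ℚ ≤ factor t
    0≤factor 1≤t t≤r = ℚP.+-mono-≤ (0≤c 1≤t t≤r) 0≤α

    extremal-suc : ∀ m → extremal (suc m) ≡ factor (suc m) * (N * extremal m)
    extremal-suc m = rearrange N (N ^ℚ suc m) (prod1to m factor) (factor (suc m))
      where
      rearrange : ∀ N Nᵐ P f → N * Nᵐ * (P * f) ≡ f * (N * (Nᵐ * P))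
      rearrange = solve 4 (λ N Nᵐ P f → N :* Nᵐ :* (P :* f) := f :* (N :* (Nᵐ :* P))) refl

    D*factor-step : ∀ {t} → 1 ℕ.≤ t → t ℕ.< r → D t * factor t ≡ D t * factor (suc t) + 1ℚ
    D*factor-step {t} 1≤t t<r = begin
      D t * (c t + α)                ≡⟨ ℚP.*-distribˡ-+ (D t) (c t) α ⟩
      D t * c t + D t * α            ≡⟨ cong (_+ D t * α) (c-step 1≤t t<r) ⟩
      D t * c (suc t) + 1ℚ + D t * α ≡⟨ rearrange (D t) (c (suc t)) α ⟩
      D t * (c (suc t) + α) + 1ℚ     ∎
      where
      open ≡-Reasoning
      rearrange : ∀ d c′ α → d * c′ + 1ℚ + d * α ≡ d * (c′ + α) + 1ℚ
      rearrange = solve 3 (λ d c′ α → d :* c′ :+ con 1ℚ :+ d :* α := d :* (c′ :+ α) :+ con 1ℚ) refl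

    grows-suc : ∀ {t} → 1 ℕ.≤ t → t ℕ.< r → Grows t → Grows (suc t)
    grows-suc {t} 1≤t t<r grows with nonneg⇒≡0⊎pos (0≤b t)
    ... | inj₁ b₀≡0 = subst (_≤ b₂) (sym growth≡0) (0≤b (suc (suc t)))
      where
      open ℚP.≤-Reasoning
      b₀ = b t
      b₁ = b (suc t)
      b₂ = b (suc (suc t))
      b₁≡0 : b₁ ≡ 0ℚ
      b₁≡0 = square≤0⇒≡0 (0≤b (suc t)) (pos-*-cancelˡ-≤ (0<D 1≤t) (begin
        D t * (b₁ * b₁)              ≤⟨ moon-moser t ⟩
        b₀ * (N * b₁ + D t * b₂)     ≡⟨ cong (_* (N * b₁ + D t * b₂)) b₀≡0 ⟩
        0ℚ * (N * b₁ + D t * b₂)     ≡⟨ ℚP.*-zeroˡ (N * b₁ + D t * b₂) ⟩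
        0ℚ                           ≡⟨ ℚP.*-zeroʳ (D t) ⟨
        D t * 0ℚ                     ∎))
      growth≡0 : factor (suc t) * (N * b₁) ≡ 0ℚ
      growth≡0 = begin-equality
        factor (suc t) * (N * b₁)    ≡⟨ cong (λ x → factor (suc t) * (N * x)) b₁≡0 ⟩
        factor (suc t) * (N * 0ℚ)    ≡⟨ cong (factor (suc t) *_) (ℚP.*-zeroʳ N) ⟩
        factor (suc t) * 0ℚ          ≡⟨ ℚP.*-zeroʳ (factor (suc t)) ⟩
        0ℚ                           ∎
    ... | inj₂ 0<b₀ =
      pos-*-cancelˡ-≤ (0<D 1≤t) (+-cancelʳ-≤ (pos-*-cancelˡ-≤ 0<b₀ (begin
        b₀ * (D t * (factor (suc t) * (N * b₁)) + N * b₁)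
          ≡⟨ weighted-identity ⟨
        D t * (b₁ * (factor t * (N * b₀)))
          ≤⟨ nonneg-*-monoˡ-≤ (ℚP.<⇒≤ (0<D 1≤t)) (nonneg-*-monoˡ-≤ (0≤b (suc t)) grows) ⟩
        D t * (b₁ * b₁)
          ≤⟨ moon-moser t ⟩
        b₀ * (N * b₁ + D t * b₂)
          ≡⟨ cong (b₀ *_) (ℚP.+-comm (N * b₁) (D t * b₂)) ⟩
        b₀ * (D t * b₂ + N * b₁) ∎)))
      where
      open ℚP.≤-Reasoning
      b₀ = b t
      b₁ = b (suc t)
      b₂ = b (suc (suc t))
      weighted-identity : D t * (b₁ * (factor t * (N * b₀))) ≡ b₀ * (D t * (factor (suc t) * (N * b₁)) + N * b₁)
      weighted-identity = begin-equality
        D t * (b₁ * (factor t * (N * b₀)))                ≡⟨ collect (D t) b₁ (factor t) N b₀ ⟩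
        b₀ * N * b₁ * (D t * factor t)                    ≡⟨ cong (b₀ * N * b₁ *_) (D*factor-step 1≤t t<r) ⟩
        b₀ * N * b₁ * (D t * factor (suc t) + 1ℚ)         ≡⟨ expand b₀ N b₁ (D t) (factor (suc t)) ⟩
        b₀ * (D t * (factor (suc t) * (N * b₁)) + N * b₁) ∎
        where
        collect : ∀ d x y n z → d * (x * (y * (n * z))) ≡ z * n * x * (d * y)
        collect = solve 5 (λ d x y n z → d :* (x :* (y :* (n :* z))) := z :* n :* x :* (d :* y)) refl
        expand : ∀ z n x d y → z * n * x * (d * y + 1ℚ) ≡ z * (d * (y * (n * x)) + n * x)
        expand = solve 5 (λ z n x d y → z :* n :* x :* (d :* y :+ con 1ℚ) := z :* (d :* (y :* (n :* x)) :+ n :* x)) refl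

    below-step : ∀ {m} → m ℕ.< r → ¬ Grows (suc m) → b (suc m) ≤ extremal m → b (suc (suc m)) < extremal (suc m)
    below-step {m} m<r ¬grows b≤extremal = begin-strict
      b (suc (suc m))                    <⟨ ℚP.≰⇒> ¬grows ⟩
      factor (suc m) * (N * b (suc m))   ≤⟨ nonneg-*-monoˡ-≤ (0≤factor (s≤s z≤n) m<r) (nonneg-*-monoˡ-≤ 0≤N b≤extremal) ⟩
      factor (suc m) * (N * extremal m)  ≡⟨ extremal-suc m ⟨
      extremal (suc m)                   ∎
      where open ℚP.≤-Reasoning

    below-extremal : ∀ {m} → 1 ℕ.≤ m → m ℕ.≤ r → ¬ Grows m → b (suc m) < extremal m
    below-extremal {1}           _ 1≤r   ¬grows = below-step 1≤r ¬grows
      (ℚP.≤-trans b₁≤N (ℚP.≤-reflexive (sym (trans (ℚP.*-identityʳ (N * 1ℚ)) (ℚP.*-identityʳ N)))))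
    below-extremal {suc (suc m)} _ m+2≤r ¬grows = below-step m+2≤r ¬grows
      (ℚP.<⇒≤ (below-extremal (s≤s z≤n) (ℕP.<⇒≤ m+2≤r) (¬grows ∘ grows-suc (s≤s z≤n) m+2≤r)))

    climb : ∀ {s m} → 1 ℕ.≤ s → s ℕ.≤′ m → m ℕ.≤ r → Grows s → extremal s ≤ b (suc s) →
            Grows m × extremal m ≤ b (suc m)
    climb 1≤s ≤′-refl _ grows above = grows , above
    climb {s} {suc m} 1≤s (≤′-step s≤′m) m<r grows above = grows′ , (begin
      extremal (suc m)                   ≡⟨ extremal-suc m ⟩
      factor (suc m) * (N * extremal m)  ≤⟨ nonneg-*-monoˡ-≤ (0≤factor (s≤s z≤n) m<r) (nonneg-*-monoˡ-≤ 0≤N (proj₂ ih)) ⟩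
      factor (suc m) * (N * b (suc m))   ≤⟨ grows′ ⟩
      b (suc (suc m))                    ∎)
      where
      open ℚP.≤-Reasoning
      ih : Grows m × extremal m ≤ b (suc m)
      ih = climb 1≤s s≤′m (ℕP.<⇒≤ m<r) grows above
      grows′ : Grows (suc m)
      grows′ = grows-suc (ℕP.≤-trans 1≤s (ℕP.≤′⇒≤ s≤′m)) m<r (proj₁ ih)

    above-extremal : ∀ {s} → 1 ℕ.≤ s → s ℕ.≤ r → extremal s ≤ b (suc s) → extremal r ≤ b (suc r)
    above-extremal {s} 1≤s s≤r above with factor s * (N * b s) ℚP.≤? b (suc s)
    ... | yes grows = proj₂ (climb 1≤s (ℕP.≤⇒≤′ s≤r) ℕP.≤-refl grows above)
    ... | no ¬grows = contradiction (ℚP.<-≤-trans (below-extremal 1≤s s≤r ¬grows) above) (ℚP.<-irrefl refl)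

  pronic : ℕ → ℚ
  pronic t = ι (t ℕ.* suc t)

  0<pronic : ∀ {t} → 1 ℕ.≤ t → 0ℚ < pronic t
  0<pronic {suc t} _ = 0<ι (suc t ℕ.+ t ℕ.* suc (suc t))

  module TuránCoefficients (r′ : ℕ) where

    open import Data.Nat.Combinatorics.Base using (_P′_)
    open import Data.Nat.Combinatorics.Specification using (nP′k≡n!/[n∸k]!)
    open import Data.Nat.DivMod using (/-congʳ; n/1≡n)

    r : ℕ
    r = suc r′

    c : ℕ → ℚ
    c t = (+ r ℤ.- + t) /ℚ (r ℕ.* t)

    +m-+n≡+[m∸n] : ∀ {m n} → n ℕ.≤ m → + m ℤ.- + n ≡ + (m ℕ.∸ n)
    +m-+n≡+[m∸n] {m} {n} n≤m = trans (ℤP.m-n≡m⊖n m n) (ℤP.⊖-≥ n≤m)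

    c-scaled : ∀ t → c (suc t) * ι (r ℕ.* suc t) ≡ fromℤ (+ r ℤ.- + suc t)
    c-scaled t = /ℚ-*-cancel (+ r ℤ.- + suc t) (t ℕ.+ r′ ℕ.* suc t)

    0≤c : ∀ {t} → 1 ℕ.≤ t → t ℕ.≤ r → 0ℚ ≤ c t
    0≤c {suc t} _ t≤r = pos-*-cancelʳ-≤ (0<ι (t ℕ.+ r′ ℕ.* suc t)) (begin
      0ℚ * ι (r ℕ.* suc t)           ≡⟨ ℚP.*-zeroˡ (ι (r ℕ.* suc t)) ⟩
      0ℚ                             ≤⟨ 0≤ι (r ℕ.∸ suc t) ⟩
      ι (r ℕ.∸ suc t)                ≡⟨ cong fromℤ (+m-+n≡+[m∸n] t≤r) ⟨
      fromℤ (+ r ℤ.- + suc t)        ≡⟨ c-scaled t ⟨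
      c (suc t) * ι (r ℕ.* suc t)    ∎)
      where open ℚP.≤-Reasoning

    c-step : ∀ {t} → 1 ℕ.≤ t → pronic t * c t ≡ pronic t * c (suc t) + 1ℚ
    c-step {suc t} _ = pos-*-cancelˡ-≡ (0<ι r′) (begin
      R * (pronic (suc t) * c (suc t))
        ≡⟨ cong (λ x → R * (x * c (suc t))) (ι-* (suc t) (suc (suc t))) ⟩
      R * (T * T′ * c (suc t))
        ≡⟨ collect R T T′ (c (suc t)) ⟩
      T′ * (c (suc t) * (R * T))
        ≡⟨ cong (λ x → T′ * (c (suc t) * x)) (ι-* r (suc t)) ⟨
      T′ * (c (suc t) * ι (r ℕ.* suc t))
        ≡⟨ cong (T′ *_) (c-scaled t) ⟩
      T′ * fromℤ (+ r ℤ.- + suc t)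
        ≡⟨ fromℤ-* (+ suc (suc t)) (+ r ℤ.- + suc t) ⟨
      fromℤ (+ suc (suc t) ℤ.* (+ r ℤ.- + suc t))
        ≡⟨ cong fromℤ (telescoping (+ r) (+ suc t)) ⟩
      fromℤ (+ suc t ℤ.* (+ r ℤ.- + suc (suc t)) ℤ.+ + r)
        ≡⟨ trans (fromℤ-+ (+ suc t ℤ.* (+ r ℤ.- + suc (suc t))) (+ r))
                 (cong (_+ R) (fromℤ-* (+ suc t) (+ r ℤ.- + suc (suc t)))) ⟩
      T * fromℤ (+ r ℤ.- + suc (suc t)) + R
        ≡⟨ cong (λ x → T * x + R) (c-scaled (suc t)) ⟨
      T * (c (suc (suc t)) * ι (r ℕ.* suc (suc t))) + R
        ≡⟨ cong (λ x → T * (c (suc (suc t)) * x) + R) (ι-* r (suc (suc t))) ⟩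
      T * (c (suc (suc t)) * (R * T′)) + R
        ≡⟨ expand R T T′ (c (suc (suc t))) ⟩
      R * (T * T′ * c (suc (suc t)) + 1ℚ)
        ≡⟨ cong (λ x → R * (x * c (suc (suc t)) + 1ℚ)) (ι-* (suc t) (suc (suc t))) ⟨
      R * (pronic (suc t) * c (suc (suc t)) + 1ℚ) ∎)
      where
      open ≡-Reasoning
      R = ι r
      T = ι (suc t)
      T′ = ι (suc (suc t))
      collect : ∀ R T T′ x → R * (T * T′ * x) ≡ T′ * (x * (R * T))
      collect = solve 4 (λ R T T′ x → R :* (T :* T′ :* x) := T′ :* (x :* (R :* T))) refl
      expand : ∀ R T T′ y → T * (y * (R * T′)) + R ≡ R * (T * T′ * y + 1ℚ)
      expand = solve 4 (λ R T T′ y → T :* (y :* (R :* T′)) :+ R := R :* (T :* T′ :* y :+ con 1ℚ)) refl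
      telescoping : ∀ r t → (+ 1 ℤ.+ t) ℤ.* (r ℤ.- t) ≡ t ℤ.* (r ℤ.- (+ 1 ℤ.+ t)) ℤ.+ r
      telescoping = ℤ-solve-∀

    c-r≡0 : c r ≡ 0ℚ
    c-r≡0 = trans (cong (_/ℚ (r ℕ.* r)) (ℤP.+-inverseʳ (+ r))) (ℚP.0/n≡0 (r ℕ.* r))

    ∏c·rᵐ·m! : ∀ {m} → m ℕ.≤ r′ → prod1to m c * (ι r ^ℚ m * ι (m ℕ.!)) ≡ ι (r′ P′ m)
    ∏c·rᵐ·m! {zero}  _     = refl
    ∏c·rᵐ·m! {suc m} m<r′ = begin
      prod1to m c * c (suc m) * (R * R ^ℚ m * ι (suc m ℕ.* m ℕ.!))
        ≡⟨ cong (λ x → prod1to m c * c (suc m) * (R * R ^ℚ m * x)) (ι-* (suc m) (m ℕ.!)) ⟩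
      prod1to m c * c (suc m) * (R * R ^ℚ m * (ι (suc m) * ι (m ℕ.!)))
        ≡⟨ regroup (prod1to m c) (c (suc m)) R (R ^ℚ m) (ι (suc m)) (ι (m ℕ.!)) ⟩
      prod1to m c * (R ^ℚ m * ι (m ℕ.!)) * (c (suc m) * (R * ι (suc m)))
        ≡⟨ cong₂ _*_ (∏c·rᵐ·m! (ℕP.<⇒≤ m<r′)) (trans (cong (c (suc m) *_) (sym (ι-* r (suc m)))) (c-scaled m)) ⟩
      ι (r′ P′ m) * fromℤ (+ r ℤ.- + suc m)
        ≡⟨ cong (λ i → ι (r′ P′ m) * fromℤ i) (+m-+n≡+[m∸n] (s≤s (ℕP.<⇒≤ m<r′))) ⟩
      ι (r′ P′ m) * ι (r′ ℕ.∸ m)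
        ≡⟨ ι-* (r′ P′ m) (r′ ℕ.∸ m) ⟨
      ι ((r′ P′ m) ℕ.* (r′ ℕ.∸ m))
        ≡⟨ cong ι (ℕP.*-comm (r′ P′ m) (r′ ℕ.∸ m)) ⟩
      ι (r′ P′ suc m) ∎
      where
      open ≡-Reasoning
      R = ι r
      regroup : ∀ P x R Rᵐ M F → P * x * (R * Rᵐ * (M * F)) ≡ P * (Rᵐ * F) * (x * (R * M))
      regroup = solve 6 (λ P x R Rᵐ M F → P :* x :* (R :* Rᵐ :* (M :* F)) := P :* (Rᵐ :* F) :* (x :* (R :* M))) refl

    ∏c·r^r′≡1 : prod1to r′ c * ι r ^ℚ r′ ≡ 1ℚ
    ∏c·r^r′≡1 = pos-*-cancelʳ-≡ (0<ι! r′) (begin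
      prod1to r′ c * ι r ^ℚ r′ * ι (r′ ℕ.!)   ≡⟨ ℚP.*-assoc (prod1to r′ c) _ _ ⟩
      prod1to r′ c * (ι r ^ℚ r′ * ι (r′ ℕ.!)) ≡⟨ ∏c·rᵐ·m! ℕP.≤-refl ⟩
      ι (r′ P′ r′)                            ≡⟨ cong ι (nP′n≡n! r′) ⟩
      ι (r′ ℕ.!)                              ≡⟨ ℚP.*-identityˡ (ι (r′ ℕ.!)) ⟨
      1ℚ * ι (r′ ℕ.!)                         ∎)
      where
      open ≡-Reasoning
      nP′n≡n! : ∀ n → n P′ n ≡ n ℕ.!
      nP′n≡n! n = trans (nP′k≡n!/[n∸k]! (ℕP.≤-refl {n}))
        (trans (/-congʳ {{(n ℕ.∸ n) ℕP.!≢0}} {{0 ℕP.!≢0}} (cong ℕ._! (ℕP.n∸n≡0 n))) (n/1≡n (n ℕ.!)))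
      0<ι! : ∀ n → 0ℚ < ι (n ℕ.!)
      0<ι! n = ℚP.<-≤-trans (0<ι 0) (ι-mono-≤ (ℕP.1≤n! n))

    scaled-bound : ∀ n α → 0ℚ ≤ α →
      ι (suc r) * (α * ((+ (r ℕ.* r) /ℚ suc r) * ((+ n /ℚ r) ^ℚ suc r))) ≤
      ι n ^ℚ suc r * prod1to r (λ t → c t + α)
    scaled-bound n α 0≤α = begin
      ι (suc r) * (α * (A * B ^ℚ suc r))
        ≡⟨ regroup (ι (suc r)) α A (B ^ℚ suc r) ⟩
      α * (A * ι (suc r)) * B ^ℚ suc r
        ≡⟨ cong (λ x → α * x * B ^ℚ suc r) (trans (/ℚ-*-cancel (+ (r ℕ.* r)) r) (ι-* r r)) ⟩
      α * (R * R) * B ^ℚ suc r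
        ≡⟨ ℚP.*-identityʳ (α * (R * R) * B ^ℚ suc r) ⟨
      α * (R * R) * B ^ℚ suc r * 1ℚ
        ≡⟨ cong (α * (R * R) * B ^ℚ suc r *_) ∏c·r^r′≡1 ⟨
      α * (R * R) * B ^ℚ suc r * (Q * R ^ℚ r′)
        ≡⟨ regroup′ α R (B ^ℚ suc r) Q (R ^ℚ r′) ⟩
      B ^ℚ suc r * R ^ℚ suc r * (Q * α)
        ≡⟨ cong (_* (Q * α)) (^ℚ-distribʳ-* B R (suc r)) ⟨
      (B * R) ^ℚ suc r * (Q * α)
        ≡⟨ cong (λ x → x ^ℚ suc r * (Q * α)) (/ℚ-*-cancel (+ n) r′) ⟩
      ι n ^ℚ suc r * (Q * α)
        ≤⟨ nonneg-*-monoˡ-≤ (nonneg-^ℚ (suc r) (0≤ι n)) Qα≤∏factor ⟩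
      ι n ^ℚ suc r * prod1to r (λ t → c t + α) ∎
      where
      open ℚP.≤-Reasoning
      A = + (r ℕ.* r) /ℚ suc r
      B = + n /ℚ r
      R = ι r
      Q = prod1to r′ c
      regroup : ∀ x α A Bᵖ → x * (α * (A * Bᵖ)) ≡ α * (A * x) * Bᵖ
      regroup = solve 4 (λ x α A Bᵖ → x :* (α :* (A :* Bᵖ)) := α :* (A :* x) :* Bᵖ) refl
      regroup′ : ∀ α R Bᵖ Q Rʳ′ → α * (R * R) * Bᵖ * (Q * Rʳ′) ≡ Bᵖ * (R * (R * Rʳ′)) * (Q * α)
      regroup′ = solve 5 (λ α R Bᵖ Q Rʳ′ → α :* (R :* R) :* Bᵖ :* (Q :* Rʳ′) := Bᵖ :* (R :* (R :* Rʳ′)) :* (Q :* α)) refl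
      0≤c′ : ∀ {t} → 1 ℕ.≤ t → t ℕ.≤ r′ → 0ℚ ≤ c t
      0≤c′ 1≤t t≤r′ = 0≤c 1≤t (ℕP.m≤n⇒m≤1+n t≤r′)
      Qα≤∏factor : Q * α ≤ prod1to r′ (λ t → c t + α) * (c r + α)
      Qα≤∏factor = nonneg-*-mono-≤ (prod1to-nonneg r′ 0≤c′) (prod1to-mono-≤ r′ 0≤c′ (λ _ _ → x≤x+y 0≤α))
        0≤α (ℚP.≤-reflexive (sym (trans (cong (_+ α) c-r≡0) (ℚP.+-identityˡ α))))

  module CliqueSequence {n : ℕ} (G : Graph n) where

    open CliqueCounting using (moon-moser-scaled; k₁≤n)

    b : ℕ → ℚ
    b t = ι (t ℕ.* k t G)

    b₁≤n : b 1 ≤ ι n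
    b₁≤n = ι-mono-≤ (subst (ℕ._≤ n) (sym (ℕP.*-identityˡ (k 1 G))) (k₁≤n G))

    moon-moserℚ : ∀ t → pronic t * (b (suc t) * b (suc t)) ≤ b t * (ι n * b (suc t) + pronic t * b (suc (suc t)))
    moon-moserℚ t = subst₂ _≤_
      (trans (ι-* (t ℕ.* suc t) (k₁ ℕ.* k₁)) (cong (pronic t *_) (ι-* k₁ k₁)))
      (trans (ι-* (t ℕ.* k t G) (n ℕ.* k₁ ℕ.+ (t ℕ.* suc t) ℕ.* k₂))
        (cong (b t *_) (trans (ι-+ (n ℕ.* k₁) ((t ℕ.* suc t) ℕ.* k₂))
                              (cong₂ _+_ (ι-* n k₁) (ι-* (t ℕ.* suc t) k₂)))))
      (ι-mono-≤ (moon-moser-scaled G t))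
      where
      k₁ = suc t ℕ.* k (suc t) G
      k₂ = suc (suc t) ℕ.* k (suc (suc t)) G

open RationalBounds

open import Data.Nat as ℕ using (ℕ; suc; _*_; _≤_; _<_)
open import Data.Integer as ℤ using (+_)
open import Data.Rational as ℚ using (ℚ)
import Data.Rational.Properties as ℚP

theorem3 : (n : ℕ) (G : Graph n) (s r : ℕ) (α : ℚ) →
    1 ≤ s → s ≤ r → r < ω G → ℚ.0ℚ ℚ.≤ α →
    ι (suc s * k (suc s) G) ℚ.≥ (ι n ^ℚ suc s) ℚ.* prod1to s (λ t → ((+ r ℤ.- + t) /ℚ (r * t)) ℚ.+ α) →
    ι (k (suc r) G) ℚ.≥ α ℚ.* ((+ (r * r) /ℚ suc r) ℚ.* ((+ n /ℚ r) ^ℚ suc r))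
theorem3 _ _ (suc _) 0 _ _ () _ _ _
theorem3 n G s (suc r′) α 1≤s s≤r _ 0≤α above = pos-*-cancelˡ-≤ (0<ι r) (begin
  ι (suc r) ℚ.* (α ℚ.* ((+ (r * r) /ℚ suc r) ℚ.* ((+ n /ℚ r) ^ℚ suc r)))  ≤⟨ scaled-bound n α 0≤α ⟩
  extremal r                                                             ≤⟨ above-extremal 1≤s s≤r above ⟩
  b (suc r)                                                              ≡⟨ ι-* (suc r) (k (suc r) G) ⟩
  ι (suc r) ℚ.* ι (k (suc r) G)                                          ∎)
  where
  open TuránCoefficients r′
  open CliqueSequence G
  open Propagation (ι n) α r b c pronic (0≤ι n) 0≤α (λ t → 0≤ι (t * k t G)) b₁≤n
    0<pronic 0≤c (λ 1≤t _ → c-step 1≤t) moon-moserℚ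
  open ℚP.≤-Reasoning
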